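{- For every $\gamma,q\in(0,1)$ and every $\alpha\geq1$, it holds that $\tilde{\mathcal{F}}_{\gamma}\nsubseteq(\mathcal{F}_{\alpha}\cup\mathcal{F}_{q})$.
   Context: All functions are set functions $f\colon 2^{U}\to\mathbb{R}_{\geq0}$ on some finite ground set $U$; $f$ is monotone if $X\subseteq Y$ implies $f(X)\leq f(Y)$. Write $[n]=\{1,\dots,n\}$. The greedy algorithm produces $x_1,x_2,\dots$ with $x_i\in\arg\max_{x\in U\setminus\{x_1,\dots,x_{i-1}\}} f(\{x_1,\dots,x_{i-1}\}\cup\{x\})$, and $S^{G}_i=\{x_1,\dots,x_i\}$, $S^{G}_0=\emptyset$; ties are broken by some rule, and each function is considered together with a fixed such greedy run, to which all notions referring to greedy sets refer. $\bar{k}\in[|U|]$ is the smallest index such that $f(S^{G}_{\bar k}\cup\{x\})=f(S^{G}_{\bar k})$ for all $x\in U\setminus S^{G}_{\bar k}$. Weak submodularity ratio: $\gamma(f)=\min_{X\in\{S^{G}_0,\dots,S^{G}_{\bar k}\},\,Y\subseteq U\setminus X}\frac{\sum_{y\in Y}(f(X\cup\{y\})-f(X))}{f(X\cup Y)-f(X)}$ with $\frac00:=1$. $\tilde{\mathcal{F}}_{\gamma}$ is the set of all monotone $f$ with $\gamma(f)\geq\gamma$. For $\alpha\geq1$, $f$ is $\alpha$-augmentable if for all $X\subseteq U$ and $Y\subseteq U$ with $Y\nsubseteq X$ there is $y\in Y\setminus X$ with $f(X\cup\{y\})-f(X)\geq\frac{f(X\cup Y)-\alpha f(X)}{|Y|}$.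 $\mathcal{F}_{\alpha}$ is the set of monotone $\alpha$-augmentable functions. An independence system $(U,\mathcal{I})$ has $\emptyset\in\mathcal{I}\subseteq 2^U$ with $\mathcal{I}$ closed under subsets. For $w\colon U\to\mathbb{R}_{\geq0}$ its weighted rank function is $f(X)=\max\{\sum_{x\in Y}w(x)\mid Y\in\mathcal{I}\cap 2^{X}\}$. The bases $\mathcal{B}(X)$ of $X$ are the inclusion-wise maximal sets of $\mathcal{I}\cap2^X$; the rank quotient is $q(U,\mathcal{I})=\min_{X\subseteq U}\min_{B,B'\in\mathcal{B}(X)}|B|/|B'|$ with $\frac00:=1$. $\mathcal{F}_q$ is the set of weighted rank functions of independence systems with rank quotient at least $q$.
   Formalization: The parameters γ, q and α range over the rationals, and the function values and the weights of weighted rank functions are rational. -}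

module Defs where

open import Data.Nat as ℕ using (ℕ; zero; suc)
open import Data.Integer using (+_)
open import Data.Rational using (ℚ; 0ℚ; 1ℚ; _+_; _-_; _*_; _≤_; _/_; _÷_; ≢-nonZero)
open import Data.Rational.Properties using (_≟_)
open import Data.Fin using (Fin; toℕ)
import Data.Fin as Fin
open import Data.Fin.Subset using (Subset; _∈_; _∉_; _⊆_; _⊈_; _∪_; ∁; ⁅_⁆; ∣_∣) renaming (⊥ to ∅)
open import Data.Vec using ([]; _∷_)
open import Data.Bool using (true; false)
open import Data.List using (List; []; _∷_; length; take; lookup)
open import Data.Product using (Σ; _×_; _,_)
open import Relation.Nullary using (¬_; yes; no)
open import Relation.Binary.PropositionalEquality using (_≡_; _≢_)

SetFn : ℕ → Set
SetFn n = Subset n → ℚ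

NonNeg : ∀ {n} → SetFn n → Set
NonNeg f = ∀ X → 0ℚ ≤ f X

Monotone : ∀ {n} → SetFn n → Set
Monotone f = ∀ X Y → X ⊆ Y → f X ≤ f Y

IsMonotoneSetFn : ∀ {n} → SetFn n → Set
IsMonotoneSetFn f = NonNeg f × Monotone f

setOf : ∀ {n} → List (Fin n) → Subset n
setOf []       = ∅
setOf (x ∷ xs) = ⁅ x ⁆ ∪ setOf xs

sumOver : ∀ {n} → Subset n → (Fin n → ℚ) → ℚ
sumOver []           g = 0ℚ
sumOver (true  ∷ p)  g = g Fin.zero + sumOver p (λ i → g (Fin.suc i))
sumOver (false ∷ p)  g = sumOver p (λ i → g (Fin.suc i))

-- a / b with the convention 0/0 := 1 (and, irrelevantly, a/0 := 1)
ratioℚ : ℚ → ℚ → ℚ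
ratioℚ a b with b ≟ 0ℚ
... | yes _  = 1ℚ
... | no b≢0 = _÷_ a b {{≢-nonZero b≢0}}

-- a / b for natural numbers with 0/0 := 1 (and a/0 := 1)
ratioℕ : ℕ → ℕ → ℚ
ratioℕ a zero    = 1ℚ
ratioℕ a (suc b) = (+ a) / suc b

-- q / m for m a natural number (only used with m ≥ 1)
_÷ℕ_ : ℚ → ℕ → ℚ
x ÷ℕ zero    = 0ℚ
x ÷ℕ (suc m) = x * ((+ 1) / suc m)

record GreedyRun {n : ℕ} (f : SetFn n) : Set where
  field
    xs : List (Fin n)
  k̄ : ℕ
  k̄ = length xs
  S : ℕ → Subset n
  S i = setOf (take i xs)
  field
    greedy-new : ∀ (i : Fin k̄) → lookup xs i ∉ S (toℕ i)
    greedy-max : ∀ (i : Fin k̄) (x : Fin n) → x ∉ S (toℕ i) →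
                 f (S (toℕ i) ∪ ⁅ x ⁆) ≤ f (S (toℕ i) ∪ ⁅ lookup xs i ⁆)
    k̄-pos : 1 ℕ.≤ k̄
    k̄-le  : k̄ ℕ.≤ n
    stops : ∀ (x : Fin n) → x ∉ S k̄ → f (S k̄ ∪ ⁅ x ⁆) ≡ f (S k̄)
    minimal : ∀ (i : ℕ) → 1 ℕ.≤ i → i ℕ.< k̄ →
              Σ (Fin n) λ x → x ∉ S i × f (S i ∪ ⁅ x ⁆) ≢ f (S i)

wsRatio : ∀ {n} → SetFn n → Subset n → Subset n → ℚ
wsRatio f X Y =
  ratioℚ (sumOver Y (λ y → f (X ∪ ⁅ y ⁆) - f X)) (f (X ∪ Y) - f X)

WSRatioAtLeast : ∀ {n} (f : SetFn n) → GreedyRun f → ℚ → Set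
WSRatioAtLeast {n} f r γ =
  ∀ (i : ℕ) → i ℕ.≤ GreedyRun.k̄ r → ∀ (Y : Subset n) → Y ⊆ ∁ (GreedyRun.S r i) →
    γ ≤ wsRatio f (GreedyRun.S r i) Y

InF̃ : ∀ {n} → ℚ → SetFn n → Set
InF̃ γ f = IsMonotoneSetFn f × Σ (GreedyRun f) λ r → WSRatioAtLeast f r γ

Augmentable : ∀ {n} → ℚ → SetFn n → Set
Augmentable {n} α f =
  ∀ (X Y : Subset n) → Y ⊈ X →
    Σ (Fin n) λ y → y ∈ Y × y ∉ X ×
      ((f (X ∪ Y) - α * f X) ÷ℕ ∣ Y ∣ ≤ f (X ∪ ⁅ y ⁆) - f X)

InFα : ∀ {n} → ℚ → SetFn n → Set
InFα α f = IsMonotoneSetFn f × Augmentable α f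

record IndependenceSystem (n : ℕ) : Set₁ where
  field
    Indep      : Subset n → Set
    indep-∅    : Indep ∅
    indep-down : ∀ X Y → X ⊆ Y → Indep Y → Indep X

IsBasis : ∀ {n} → IndependenceSystem n → Subset n → Subset n → Set
IsBasis 𝓘 X B =
  B ⊆ X × Indep B × (∀ Z → B ⊆ Z → Z ⊆ X → Indep Z → Z ≡ B)
  where open IndependenceSystem 𝓘

RankQuotientAtLeast : ∀ {n} → IndependenceSystem n → ℚ → Set
RankQuotientAtLeast {n} 𝓘 q =
  ∀ (X B B′ : Subset n) → IsBasis 𝓘 X B → IsBasis 𝓘 X B′ → q ≤ ratioℕ ∣ B ∣ ∣ B′ ∣

weight : ∀ {n} → (Fin n → ℚ) → Subset n → ℚ
weight w Y = sumOver Y w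

IsMaxWeight : ∀ {n} → IndependenceSystem n → (Fin n → ℚ) → Subset n → ℚ → Set
IsMaxWeight {n} 𝓘 w X v =
  (Σ (Subset n) λ Y → Y ⊆ X × Indep Y × weight w Y ≡ v) ×
  (∀ (Y : Subset n) → Y ⊆ X → Indep Y → weight w Y ≤ v)
  where open IndependenceSystem 𝓘

IsWeightedRankFn : ∀ {n} → IndependenceSystem n → (Fin n → ℚ) → SetFn n → Set
IsWeightedRankFn 𝓘 w f = ∀ X → IsMaxWeight 𝓘 w X (f X)

InFq : ∀ {n} → ℚ → SetFn n → Set₁
InFq {n} q f =
  Σ (IndependenceSystem n) λ 𝓘 → Σ (Fin n → ℚ) λ w →
    (∀ x → 0ℚ ≤ w x) × RankQuotientAtLeast 𝓘 q × IsWeightedRankFn 𝓘 w f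

{-# OPTIONS --safe #-}
-- Take two points whose singletons are worth γ/2 each while the pair is worth 1.
-- From ∅ the pair has weak submodularity ratio (γ/2 + γ/2)/1 = γ, and every other
-- admissible Y is empty or a singleton, with ratio 1; so γ(f) = γ.  But f is not
-- subadditive, as every weighted rank function is, and augmentability at X = ∅,
-- Y = U would force some singleton to be worth at least f(U)/2 = 1/2 > γ/2.
module Submission where

open import Defs
open import Data.Nat using (ℕ)
open import Data.Rational using (ℚ; 0ℚ; 1ℚ; _<_; _≤_)
open import Data.Product using (Σ; _×_)
open import Relation.Nullary using (¬_)

open import Algebra.Bundles using (CommutativeMonoid)
open import Data.Nat as ℕ using (z≤n; s≤s)
open import Data.Rational using (½; _+_; _-_; _*_; ≢-nonZero)
open import Data.Rational.Properties as ℚ using (_≟_)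
open import Data.Fin using (Fin; zero; suc)
open import Data.Fin.Subset using (Subset; _∈_; _∉_; _⊆_; _⊈_; _∪_; _∩_; ∁; ⁅_⁆; ∣_∣)
  renaming (⊥ to ∅)
open import Data.Fin.Subset.Properties
  using (p∩q⊆p; p∩q⊆q; x∈p∩q⁻; x∈p∪q⁻; x∈∁p⇒x∉p; ∪-identityˡ; ∪-identityʳ)
open import Data.Vec using ([]; _∷_; here; there)
open import Data.Bool using (true; false)
open import Data.List using ([]; _∷_)
open import Data.Product using (_,_; proj₁; proj₂)
open import Data.Sum using (inj₁; inj₂)
open import Relation.Nullary using (yes; no; contradiction)
open import Relation.Nullary.Decidable using (from-yes)
open import Relation.Binary.PropositionalEquality
  using (_≡_; refl; sym; trans; cong; cong₂; subst; subst₂; module ≡-Reasoning)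
open import Algebra.Properties.CommutativeSemigroup
  (CommutativeMonoid.commutativeSemigroup ℚ.+-0-commutativeMonoid)
  using (x∙yz≈y∙xz)

ratioℚ-zero : ∀ a {b} → b ≡ 0ℚ → ratioℚ a b ≡ 1ℚ
ratioℚ-zero a {b} b≡0 with b ≟ 0ℚ
... | yes _  = refl
... | no b≢0 = contradiction b≡0 b≢0

ratioℚ-self : ∀ a → ratioℚ a a ≡ 1ℚ
ratioℚ-self a with a ≟ 0ℚ
... | yes _  = refl
... | no a≢0 = ℚ.*-inverseʳ a {{≢-nonZero a≢0}}

sumOver-∅ : ∀ {n} (g : Fin n → ℚ) → sumOver ∅ g ≡ 0ℚ
sumOver-∅ {ℕ.zero}  g = refl
sumOver-∅ {ℕ.suc n} g = sumOver-∅ (λ i → g (suc i))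

sumOver-⁅⁆ : ∀ {n} (y : Fin n) (g : Fin n → ℚ) → sumOver ⁅ y ⁆ g ≡ g y
sumOver-⁅⁆ zero    g = trans (cong (g zero +_) (sumOver-∅ (λ i → g (suc i)))) (ℚ.+-identityʳ (g zero))
sumOver-⁅⁆ (suc y) g = sumOver-⁅⁆ y (λ i → g (suc i))

sumOver-split : ∀ {n} (Z X : Subset n) (g : Fin n → ℚ) →
                sumOver Z g ≡ sumOver (Z ∩ X) g + sumOver (Z ∩ ∁ X) g
sumOver-split []          []          g = sym (ℚ.+-identityʳ 0ℚ)
sumOver-split (false ∷ Z) (_ ∷ X)     g = sumOver-split Z X (λ i → g (suc i))
sumOver-split {ℕ.suc n} (true ∷ Z) (true ∷ X) g =
  trans (cong (g zero +_) (sumOver-split Z X g′)) (sym (ℚ.+-assoc (g zero) (sumOver (Z ∩ X) g′) _))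
  where
  g′ : Fin n → ℚ
  g′ i = g (suc i)
sumOver-split {ℕ.suc n} (true ∷ Z) (false ∷ X) g =
  trans (cong (g zero +_) (sumOver-split Z X g′)) (x∙yz≈y∙xz (g zero) (sumOver (Z ∩ X) g′) _)
  where
  g′ : Fin n → ℚ
  g′ i = g (suc i)

weightedRank-subadditive : ∀ {n} (𝓘 : IndependenceSystem n) {w : Fin n → ℚ} {f : SetFn n} →
                           IsWeightedRankFn 𝓘 w f → ∀ X Y → f (X ∪ Y) ≤ f X + f Y
weightedRank-subadditive 𝓘 {w} {f} rank X Y with proj₁ (rank (X ∪ Y))
... | Z , Z⊆X∪Y , indep-Z , wZ≡f[X∪Y] = begin
  f (X ∪ Y)                               ≡⟨ sym wZ≡f[X∪Y] ⟩
  weight w Z                              ≡⟨ sumOver-split Z X w ⟩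
  weight w (Z ∩ X) + weight w (Z ∩ ∁ X)   ≤⟨ ℚ.+-mono-≤ (bound X (p∩q⊆q Z X) (p∩q⊆p Z X))
                                                         (bound Y Z∖X⊆Y (p∩q⊆p Z (∁ X))) ⟩
  f X + f Y                               ∎
  where
  open IndependenceSystem 𝓘
  open ℚ.≤-Reasoning

  bound : ∀ V {Z′} → Z′ ⊆ V → Z′ ⊆ Z → weight w Z′ ≤ f V
  bound V Z′⊆V Z′⊆Z = proj₂ (rank V) _ Z′⊆V (indep-down _ _ Z′⊆Z indep-Z)

  Z∖X⊆Y : Z ∩ ∁ X ⊆ Y
  Z∖X⊆Y x∈Z∖X with x∈p∩q⁻ Z (∁ X) x∈Z∖X
  ... | x∈Z , x∈∁X with x∈p∪q⁻ X Y (Z⊆X∪Y x∈Z)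
  ...   | inj₁ x∈X = contradiction x∈X (x∈∁p⇒x∉p x∈∁X)
  ...   | inj₂ x∈Y = x∈Y

augmentable⇒singleton≥average : ∀ {n α} {f : SetFn n} → Augmentable α f → f ∅ ≡ 0ℚ →
  ∀ Y → Y ⊈ ∅ → Σ (Fin n) λ y → y ∈ Y × f Y ÷ℕ ∣ Y ∣ ≤ f ⁅ y ⁆
augmentable⇒singleton≥average {α = α} {f} aug f∅≡0 Y Y⊈∅ with aug ∅ Y Y⊈∅
... | y , y∈Y , _ , gain = y , y∈Y , subst₂ _≤_ (cong (_÷ℕ ∣ Y ∣) average) (gain≡ y) gain
  where
  open ≡-Reasoning

  minus-f∅ : ∀ a → a - f ∅ ≡ a
  minus-f∅ a = trans (cong (a -_) f∅≡0) (ℚ.+-identityʳ a)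

  average : f (∅ ∪ Y) - α * f ∅ ≡ f Y
  average = begin
    f (∅ ∪ Y) - α * f ∅   ≡⟨ cong₂ (λ A c → f A - α * c) (∪-identityˡ Y) f∅≡0 ⟩
    f Y - α * 0ℚ          ≡⟨ cong (f Y -_) (ℚ.*-zeroʳ α) ⟩
    f Y - 0ℚ              ≡⟨ ℚ.+-identityʳ (f Y) ⟩
    f Y                   ∎

  gain≡ : ∀ y → f (∅ ∪ ⁅ y ⁆) - f ∅ ≡ f ⁅ y ⁆
  gain≡ y = trans (minus-f∅ _) (cong f (∪-identityˡ ⁅ y ⁆))

wsRatio-∅ : ∀ {n} (f : SetFn n) X → wsRatio f X ∅ ≡ 1ℚ
wsRatio-∅ f X =
  ratioℚ-zero _ (trans (cong (λ A → f A - f X) (∪-identityʳ X)) (ℚ.+-inverseʳ (f X)))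

wsRatio-⁅⁆ : ∀ {n} (f : SetFn n) X y → wsRatio f X ⁅ y ⁆ ≡ 1ℚ
wsRatio-⁅⁆ {n} f X y =
  trans (cong (λ a → ratioℚ a (gain y)) (sumOver-⁅⁆ y gain)) (ratioℚ-self (gain y))
  where
  gain : Fin n → ℚ
  gain x = f (X ∪ ⁅ x ⁆) - f X

0<1 : 0ℚ < 1ℚ
0<1 = from-yes (0ℚ ℚ.<? 1ℚ)

½<1 : ½ < 1ℚ
½<1 = from-yes (½ ℚ.<? 1ℚ)

module TwoPointExample (γ : ℚ) (0<γ : 0ℚ < γ) (γ<1 : γ < 1ℚ) where

  γ/2 : ℚ
  γ/2 = γ * ½

  U : Subset 2
  U = true ∷ true ∷ []

  f : SetFn 2
  f (false ∷ false ∷ []) = 0ℚ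
  f (true  ∷ false ∷ []) = γ/2
  f (false ∷ true  ∷ []) = γ/2
  f (true  ∷ true  ∷ []) = 1ℚ

  γ/2+γ/2≡γ : γ/2 + γ/2 ≡ γ
  γ/2+γ/2≡γ = trans (sym (ℚ.*-distribˡ-+ γ ½ ½)) (ℚ.*-identityʳ γ)

  0≤γ/2 : 0ℚ ≤ γ/2
  0≤γ/2 = ℚ.*-monoʳ-≤-nonNeg ½ (ℚ.<⇒≤ 0<γ)

  γ/2<½ : γ/2 < ½
  γ/2<½ = ℚ.*-monoˡ-<-pos ½ γ<1

  γ/2<1 : γ/2 < 1ℚ
  γ/2<1 = ℚ.<-trans γ/2<½ ½<1

  0∉ : ∀ {b} → zero ∉ (false ∷ b ∷ [])
  0∉ ()

  1∉ : ∀ {b} → suc zero ∉ (b ∷ false ∷ [])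
  1∉ (there ())

  nonNeg : NonNeg f
  nonNeg (false ∷ false ∷ []) = ℚ.≤-refl
  nonNeg (true  ∷ false ∷ []) = 0≤γ/2
  nonNeg (false ∷ true  ∷ []) = 0≤γ/2
  nonNeg (true  ∷ true  ∷ []) = ℚ.<⇒≤ 0<1

  f≤1 : ∀ X → f X ≤ 1ℚ
  f≤1 (false ∷ false ∷ []) = ℚ.<⇒≤ 0<1
  f≤1 (true  ∷ false ∷ []) = ℚ.<⇒≤ γ/2<1
  f≤1 (false ∷ true  ∷ []) = ℚ.<⇒≤ γ/2<1
  f≤1 (true  ∷ true  ∷ []) = ℚ.≤-refl

  monotone : Monotone f
  monotone (false ∷ false ∷ []) Y                    _ = nonNeg Y
  monotone (true  ∷ false ∷ []) (true  ∷ false ∷ []) _ = ℚ.≤-refl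
  monotone (false ∷ true  ∷ []) (false ∷ true  ∷ []) _ = ℚ.≤-refl
  monotone X                    (true  ∷ true  ∷ []) _ = f≤1 X
  monotone (true  ∷ _     ∷ []) (false ∷ _     ∷ []) X⊆Y = contradiction (X⊆Y here) 0∉
  monotone (_     ∷ true  ∷ []) (_     ∷ false ∷ []) X⊆Y = contradiction (X⊆Y (there here)) 1∉

  run : GreedyRun f
  run = record
    { xs         = zero ∷ suc zero ∷ []
    ; greedy-new = λ { zero () ; (suc zero) → 1∉ }
    ; greedy-max = λ { zero       zero       _  → ℚ.≤-refl
                     ; zero       (suc zero) _  → ℚ.≤-refl
                     ; (suc zero) zero       x∉ → contradiction here x∉
                     ; (suc zero) (suc zero) _  → ℚ.≤-refl
                     }
    ; k̄-pos      = s≤s z≤n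
    ; k̄-le       = s≤s (s≤s z≤n)
    ; stops      = λ { zero       x∉ → contradiction here x∉
                     ; (suc zero) x∉ → contradiction (there here) x∉
                     }
    ; minimal    = λ { 1 _ _ → suc zero , 1∉ , λ 1≡γ/2 → ℚ.<-irrefl (sym 1≡γ/2) γ/2<1
                     ; (ℕ.suc (ℕ.suc _)) _ (s≤s (s≤s ()))
                     }
    }

  γ≤ratio≡1 : ∀ {r} → r ≡ 1ℚ → γ ≤ r
  γ≤ratio≡1 r≡1 = subst (γ ≤_) (sym r≡1) (ℚ.<⇒≤ γ<1)

  wsRatio-∅-U : wsRatio f ∅ U ≡ γ
  wsRatio-∅-U = begin
    wsRatio f ∅ U                              ≡⟨ ℚ.*-identityʳ _ ⟩
    (γ/2 - 0ℚ) + ((γ/2 - 0ℚ) + 0ℚ)             ≡⟨ cong₂ _+_ (ℚ.+-identityʳ γ/2)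
                                                            (trans (ℚ.+-identityʳ _) (ℚ.+-identityʳ γ/2)) ⟩
    γ/2 + γ/2                                  ≡⟨ γ/2+γ/2≡γ ⟩
    γ                                          ∎
    where open ≡-Reasoning

  weakSubmodularity : WSRatioAtLeast f run γ
  weakSubmodularity 0 _ (false ∷ false ∷ []) _ = γ≤ratio≡1 (wsRatio-∅ f ∅)
  weakSubmodularity 0 _ (true  ∷ false ∷ []) _ = γ≤ratio≡1 (wsRatio-⁅⁆ f ∅ zero)
  weakSubmodularity 0 _ (false ∷ true  ∷ []) _ = γ≤ratio≡1 (wsRatio-⁅⁆ f ∅ (suc zero))
  weakSubmodularity 0 _ (true  ∷ true  ∷ []) _ = ℚ.≤-reflexive (sym wsRatio-∅-U)
  weakSubmodularity 1 _ (false ∷ false ∷ []) _ = γ≤ratio≡1 (wsRatio-∅ f ⁅ zero ⁆)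
  weakSubmodularity 1 _ (false ∷ true  ∷ []) _ = γ≤ratio≡1 (wsRatio-⁅⁆ f ⁅ zero ⁆ (suc zero))
  weakSubmodularity 1 _ (true  ∷ _     ∷ []) Y⊆∁S = contradiction (Y⊆∁S here) 0∉
  weakSubmodularity 2 _ (false ∷ false ∷ []) _ = γ≤ratio≡1 (wsRatio-∅ f U)
  weakSubmodularity 2 _ (true  ∷ _     ∷ []) Y⊆∁S = contradiction (Y⊆∁S here) 0∉
  weakSubmodularity 2 _ (false ∷ true  ∷ []) Y⊆∁S = contradiction (Y⊆∁S (there here)) 1∉
  weakSubmodularity (ℕ.suc (ℕ.suc (ℕ.suc _))) (s≤s (s≤s ())) _ _

  inF̃ : InF̃ γ f
  inF̃ = (nonNeg , monotone) , run , weakSubmodularity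

  singleton<½ : ∀ y → f ⁅ y ⁆ < ½
  singleton<½ zero       = γ/2<½
  singleton<½ (suc zero) = γ/2<½

  notInFα : ∀ α → ¬ InFα α f
  notInFα α (_ , augmentable)
    with augmentable⇒singleton≥average {α = α} {f} augmentable refl U
           (λ U⊆∅ → contradiction (U⊆∅ here) λ ())
  ... | y , _ , ½≤f⁅y⁆ = ℚ.<-irrefl refl (ℚ.<-≤-trans (singleton<½ y) ½≤f⁅y⁆)

  notInFq : ∀ q → ¬ InFq q f
  notInFq q (𝓘 , _ , _ , _ , rank) =
    ℚ.<-irrefl refl (ℚ.<-≤-trans γ<1 (subst (1ℚ ≤_) γ/2+γ/2≡γ
      (weightedRank-subadditive 𝓘 rank ⁅ zero ⁆ ⁅ suc zero ⁆)))

proposition15 : ∀ (γ q α : ℚ) → 0ℚ < γ → γ < 1ℚ → 0ℚ < q → q < 1ℚ → 1ℚ ≤ α →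
    Σ ℕ λ n → Σ (SetFn n) λ f → InF̃ γ f × ¬ InFα α f × ¬ InFq q f
proposition15 γ q α 0<γ γ<1 _ _ _ = 2 , f , inF̃ , notInFα α , notInFq q
  where open TwoPointExample γ 0<γ γ<1
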